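{- Let $S$ be a c-lattice and $\mathscr{N}(S)=\{x\in S\mid x\cdot 0=0\}$. Then $0,1_\sigma,\overline{1}_\pi\in\mathscr{N}(S)$, $\mathscr{N}(S)$ is closed under $+$, $\sqcap$, $\cdot$ and $\|$, $\overline{1}_\pi$ is the greatest element of $\mathscr{N}(S)$, $x\cdot 0=0$ for all $x\in\mathscr{N}(S)$ (so $0$ is a right annihilator of $\cdot$ on $\mathscr{N}(S)$), and if $S$ has more than one element then $1_\pi\notin\mathscr{N}(S)$. If moreover the lattice reduct of $S$ is a Boolean algebra, then $\mathscr{N}(S)$ is a Boolean algebra (with bounds $0$ and $\overline{1}_\pi$).
   Context: A proto-trioid is $(S,+,\cdot,\|,0,1_\sigma,1_\pi)$ where $(S,+,0)$ is a join semilattice with least element $0$ (order $x\le y\iff x+y=y$); $1_\sigma\cdot x=x=x\cdot 1_\sigma$; $x\cdot y+x\cdot z\le x\cdot(y+z)$; $(x+y)\cdot z=x\cdot z+y\cdot z$; $0\cdot x=0$; $\|$ is associative and commutative with unit $1_\pi$, distributes over $+$, and $0\|x=0$. A c-lattice is a structure $(S,+,\sqcap,\cdot,\|,0,1_\sigma,1_\pi,U,\overline{1}_\pi)$ such that $(S,+,\sqcap,0,U)$ is a bounded distributive lattice with least element $0$ and greatest element $U$, $(S,+,\cdot,\|,0,1_\sigma,1_\pi)$ is a proto-trioid, and for all $x,y,z$: (cl1) $x\cdot 1_\pi+x\cdot\overline{1}_\pi=x\cdot U$; (cl2) $1_\pi\sqcap(x+\overline{1}_\pi)=x\cdot 0$;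 (cl3) $x\cdot(y\|z)\le(x\cdot y)\|(x\cdot z)$; (cl4) $z\|z\le z\Rightarrow (x\|y)\cdot z=(x\cdot z)\|(y\cdot z)$; (cl5) $x\cdot(y\cdot(z\cdot 0))=(x\cdot y)\cdot(z\cdot 0)$; (cl6) $(x\cdot 0)\cdot y=x\cdot(0\cdot y)$; (cl7) $1_\sigma\|1_\sigma=1_\sigma$; (cl8) $((x\cdot 1_\pi)\|1_\sigma)\cdot y=(x\cdot 1_\pi)\|y$; (cl9) $((x\sqcap 1_\sigma)\cdot 1_\pi)\|1_\sigma=x\sqcap 1_\sigma$; (cl10) $((x\sqcap\overline{1}_\pi)\cdot 1_\pi)\|1_\sigma=1_\sigma\sqcap((x\sqcap\overline{1}_\pi)\cdot\overline{1}_\pi)$; (cl11) $((x\sqcap\overline{1}_\pi)\cdot 1_\pi)\|\overline{1}_\pi=(x\sqcap\overline{1}_\pi)\cdot\overline{1}_\pi$. -}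

module Defs where

open import Level using (Level; suc; _⊔_)
open import Relation.Binary.PropositionalEquality using (_≡_)
open import Data.Product using (Σ; _×_; ∃; ∃-syntax)

record CLattice (ℓ : Level) : Set (suc ℓ) where
  infixr 6 _+_
  infixr 7 _⊓_
  infixr 8 _∥_
  infixr 9 _·_
  infix 4 _≤_
  field
    S    : Set ℓ
    _+_  : S → S → S
    _⊓_  : S → S → S
    _·_  : S → S → S
    _∥_  : S → S → S
    𝟎    : S
    1σ   : S
    1π   : S
    U    : S
    1̄π   : S

  _≤_ : S → S → Set ℓ
  x ≤ y = x + y ≡ y

  field
    +-assoc  : ∀ x y z → (x + y) + z ≡ x + (y + z)
    +-comm   : ∀ x y → x + y ≡ y + x
    +-idem   : ∀ x → x + x ≡ x
    ⊓-assoc  : ∀ x y z → (x ⊓ y) ⊓ z ≡ x ⊓ (y ⊓ z)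
    ⊓-comm   : ∀ x y → x ⊓ y ≡ y ⊓ x
    ⊓-idem   : ∀ x → x ⊓ x ≡ x
    +-absorbs-⊓ : ∀ x y → x + (x ⊓ y) ≡ x
    ⊓-absorbs-+ : ∀ x y → x ⊓ (x + y) ≡ x
    ⊓-distrib-+ : ∀ x y z → x ⊓ (y + z) ≡ (x ⊓ y) + (x ⊓ z)
    +-distrib-⊓ : ∀ x y z → x + (y ⊓ z) ≡ (x + y) ⊓ (x + z)
    𝟎-least  : ∀ x → 𝟎 + x ≡ x
    U-greatest : ∀ x → x + U ≡ U
    ·-identityˡ : ∀ x → 1σ · x ≡ x
    ·-identityʳ : ∀ x → x · 1σ ≡ x
    ·-subdistribˡ : ∀ x y z → (x · y) + (x · z) ≤ x · (y + z)
    ·-distribʳ : ∀ x y z → (x + y) · z ≡ (x · z) + (y · z)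
    ·-zeroˡ : ∀ x → 𝟎 · x ≡ 𝟎
    ∥-assoc : ∀ x y z → (x ∥ y) ∥ z ≡ x ∥ (y ∥ z)
    ∥-comm  : ∀ x y → x ∥ y ≡ y ∥ x
    ∥-identity : ∀ x → 1π ∥ x ≡ x
    ∥-distrib-+ : ∀ x y z → x ∥ (y + z) ≡ (x ∥ y) + (x ∥ z)
    ∥-zero : ∀ x → 𝟎 ∥ x ≡ 𝟎
    cl1 : ∀ x → (x · 1π) + (x · 1̄π) ≡ x · U
    cl2 : ∀ x → 1π ⊓ (x + 1̄π) ≡ x · 𝟎
    cl3 : ∀ x y z → x · (y ∥ z) ≤ (x · y) ∥ (x · z)
    cl4 : ∀ x y z → z ∥ z ≤ z → (x ∥ y) · z ≡ (x · z) ∥ (y · z)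
    cl5 : ∀ x y z → x · (y · (z · 𝟎)) ≡ (x · y) · (z · 𝟎)
    cl6 : ∀ x y → (x · 𝟎) · y ≡ x · (𝟎 · y)
    cl7 : 1σ ∥ 1σ ≡ 1σ
    cl8 : ∀ x y → ((x · 1π) ∥ 1σ) · y ≡ (x · 1π) ∥ y
    cl9 : ∀ x → ((x ⊓ 1σ) · 1π) ∥ 1σ ≡ x ⊓ 1σ
    cl10 : ∀ x → ((x ⊓ 1̄π) · 1π) ∥ 1σ ≡ 1σ ⊓ ((x ⊓ 1̄π) · 1̄π)
    cl11 : ∀ x → ((x ⊓ 1̄π) · 1π) ∥ 1̄π ≡ (x ⊓ 1̄π) · 1̄π

  𝒩 : S → Set ℓ
  𝒩 x = x · 𝟎 ≡ 𝟎

  IsBooleanReduct : Set ℓ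
  IsBooleanReduct = ∀ x → ∃[ y ] (x + y ≡ U × x ⊓ y ≡ 𝟎)

  𝒩IsBoolean : Set ℓ
  𝒩IsBoolean = ∀ x → 𝒩 x → ∃[ y ] (𝒩 y × x + y ≡ 1̄π × x ⊓ y ≡ 𝟎)

module Submission where

-- By cl1 at 1σ and cl2 at 0, the elements 1π and 1̄π are complements in the
-- distributive lattice S; then cl2 says that x · 0 = 1π ⊓ x. Hence 𝒩(S) is the
-- set of elements disjoint from 1π, i.e. the principal ideal below 1̄π, which is
-- a sublattice and, when S is Boolean, a Boolean algebra under relative
-- complement y ⊓ 1̄π. Closure under · and ∥ comes from cl5 and cl4 with z = 1σ
-- resp. z = 0, and 𝒩 1π forces 1π = 0, which collapses S since 0 ∥ x = 0.

open import Defs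
open import Level using (Level)
open import Relation.Binary.PropositionalEquality
  using (_≡_; _≢_; sym; trans; cong; cong₂; module ≡-Reasoning)
open import Relation.Nullary using (¬_)
open import Data.Product using (_×_; Σ; _,_)

module _ {ℓ : Level} (C : CLattice ℓ) where
  open CLattice C
  open ≡-Reasoning

  +-identityʳ : ∀ x → x + 𝟎 ≡ x
  +-identityʳ x = trans (+-comm x 𝟎) (𝟎-least x)

  ⊓-zeroˡ : ∀ x → 𝟎 ⊓ x ≡ 𝟎
  ⊓-zeroˡ x = trans (cong (𝟎 ⊓_) (sym (𝟎-least x))) (⊓-absorbs-+ 𝟎 x)

  ⊓-identityʳ : ∀ x → x ⊓ U ≡ x
  ⊓-identityʳ x = trans (cong (x ⊓_) (sym (U-greatest x))) (⊓-absorbs-+ x U)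

  ⊓≡⇒≤ : ∀ x y → x ⊓ y ≡ x → x ≤ y
  ⊓≡⇒≤ x y eq = begin
    x + y        ≡⟨ cong (_+ y) (sym eq) ⟩
    x ⊓ y + y    ≡⟨ +-comm (x ⊓ y) y ⟩
    y + x ⊓ y    ≡⟨ cong (y +_) (⊓-comm x y) ⟩
    y + y ⊓ x    ≡⟨ +-absorbs-⊓ y x ⟩
    y            ∎

  1π+1̄π≡U : 1π + 1̄π ≡ U
  1π+1̄π≡U = begin
    1π + 1̄π                ≡⟨ cong₂ _+_ (sym (·-identityˡ 1π)) (sym (·-identityˡ 1̄π)) ⟩
    1σ · 1π + 1σ · 1̄π      ≡⟨ cl1 1σ ⟩
    1σ · U                 ≡⟨ ·-identityˡ U ⟩
    U                      ∎

  1π⊓1̄π≡𝟎 : 1π ⊓ 1̄π ≡ 𝟎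
  1π⊓1̄π≡𝟎 = begin
    1π ⊓ 1̄π          ≡⟨ cong (1π ⊓_) (sym (𝟎-least 1̄π)) ⟩
    1π ⊓ (𝟎 + 1̄π)    ≡⟨ cl2 𝟎 ⟩
    𝟎 · 𝟎            ≡⟨ ·-zeroˡ 𝟎 ⟩
    𝟎                ∎

  ·𝟎≡1π⊓ : ∀ x → x · 𝟎 ≡ 1π ⊓ x
  ·𝟎≡1π⊓ x = begin
    x · 𝟎                  ≡⟨ sym (cl2 x) ⟩
    1π ⊓ (x + 1̄π)          ≡⟨ ⊓-distrib-+ 1π x 1̄π ⟩
    1π ⊓ x + 1π ⊓ 1̄π      ≡⟨ cong (1π ⊓ x +_) 1π⊓1̄π≡𝟎 ⟩
    1π ⊓ x + 𝟎             ≡⟨ +-identityʳ (1π ⊓ x) ⟩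
    1π ⊓ x                 ∎

  𝒩⇒1π⊓≡𝟎 : ∀ {x} → 𝒩 x → 1π ⊓ x ≡ 𝟎
  𝒩⇒1π⊓≡𝟎 {x} hx = trans (sym (·𝟎≡1π⊓ x)) hx

  1π⊓≡𝟎⇒𝒩 : ∀ {x} → 1π ⊓ x ≡ 𝟎 → 𝒩 x
  1π⊓≡𝟎⇒𝒩 {x} eq = trans (·𝟎≡1π⊓ x) eq

  𝒩-𝟎 : 𝒩 𝟎
  𝒩-𝟎 = ·-zeroˡ 𝟎

  𝒩-1σ : 𝒩 1σ
  𝒩-1σ = ·-identityˡ 𝟎

  𝒩-⊓1̄π : ∀ x → 𝒩 (x ⊓ 1̄π)
  𝒩-⊓1̄π x = 1π⊓≡𝟎⇒𝒩 (begin
    1π ⊓ (x ⊓ 1̄π)    ≡⟨ sym (⊓-assoc 1π x 1̄π) ⟩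
    (1π ⊓ x) ⊓ 1̄π    ≡⟨ cong (_⊓ 1̄π) (⊓-comm 1π x) ⟩
    (x ⊓ 1π) ⊓ 1̄π    ≡⟨ ⊓-assoc x 1π 1̄π ⟩
    x ⊓ (1π ⊓ 1̄π)    ≡⟨ cong (x ⊓_) 1π⊓1̄π≡𝟎 ⟩
    x ⊓ 𝟎            ≡⟨ ⊓-comm x 𝟎 ⟩
    𝟎 ⊓ x            ≡⟨ ⊓-zeroˡ x ⟩
    𝟎                ∎)

  𝒩-1̄π : 𝒩 1̄π
  𝒩-1̄π = trans (cong (_· 𝟎) (sym (⊓-idem 1̄π))) (𝒩-⊓1̄π 1̄π)

  𝒩-+ : ∀ x y → 𝒩 x → 𝒩 y → 𝒩 (x + y)
  𝒩-+ x y hx hy = 1π⊓≡𝟎⇒𝒩 (begin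
    1π ⊓ (x + y)          ≡⟨ ⊓-distrib-+ 1π x y ⟩
    1π ⊓ x + 1π ⊓ y       ≡⟨ cong₂ _+_ (𝒩⇒1π⊓≡𝟎 hx) (𝒩⇒1π⊓≡𝟎 hy) ⟩
    𝟎 + 𝟎                 ≡⟨ +-idem 𝟎 ⟩
    𝟎                     ∎)

  𝒩-⊓ : ∀ x y → 𝒩 x → 𝒩 y → 𝒩 (x ⊓ y)
  𝒩-⊓ x y hx _ = 1π⊓≡𝟎⇒𝒩 (begin
    1π ⊓ (x ⊓ y)     ≡⟨ sym (⊓-assoc 1π x y) ⟩
    (1π ⊓ x) ⊓ y     ≡⟨ cong (_⊓ y) (𝒩⇒1π⊓≡𝟎 hx) ⟩
    𝟎 ⊓ y            ≡⟨ ⊓-zeroˡ y ⟩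
    𝟎                ∎)

  𝒩-· : ∀ x y → 𝒩 x → 𝒩 y → 𝒩 (x · y)
  𝒩-· x y hx hy = begin
    (x · y) · 𝟎            ≡⟨ cong ((x · y) ·_) (sym 𝒩-1σ) ⟩
    (x · y) · (1σ · 𝟎)     ≡⟨ sym (cl5 x y 1σ) ⟩
    x · (y · (1σ · 𝟎))     ≡⟨ cong (λ t → x · (y · t)) 𝒩-1σ ⟩
    x · (y · 𝟎)            ≡⟨ cong (x ·_) hy ⟩
    x · 𝟎                  ≡⟨ hx ⟩
    𝟎                      ∎

  𝟎∥𝟎≤𝟎 : 𝟎 ∥ 𝟎 ≤ 𝟎
  𝟎∥𝟎≤𝟎 = trans (cong (_+ 𝟎) (∥-zero 𝟎)) (+-idem 𝟎)

  𝒩-∥ : ∀ x y → 𝒩 x → 𝒩 y → 𝒩 (x ∥ y)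
  𝒩-∥ x y hx hy = begin
    (x ∥ y) · 𝟎          ≡⟨ cl4 x y 𝟎 𝟎∥𝟎≤𝟎 ⟩
    (x · 𝟎) ∥ (y · 𝟎)    ≡⟨ cong₂ _∥_ hx hy ⟩
    𝟎 ∥ 𝟎                ≡⟨ ∥-zero 𝟎 ⟩
    𝟎                    ∎

  𝒩⇒⊓1̄π≡ : ∀ x → 𝒩 x → x ⊓ 1̄π ≡ x
  𝒩⇒⊓1̄π≡ x hx = sym (begin
    x                        ≡⟨ sym (⊓-identityʳ x) ⟩
    x ⊓ U                    ≡⟨ cong (x ⊓_) (sym 1π+1̄π≡U) ⟩
    x ⊓ (1π + 1̄π)            ≡⟨ ⊓-distrib-+ x 1π 1̄π ⟩
    x ⊓ 1π + x ⊓ 1̄π          ≡⟨ cong (_+ x ⊓ 1̄π) (trans (⊓-comm x 1π) (𝒩⇒1π⊓≡𝟎 hx)) ⟩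
    𝟎 + x ⊓ 1̄π               ≡⟨ 𝟎-least (x ⊓ 1̄π) ⟩
    x ⊓ 1̄π                   ∎)

  𝒩⇒≤1̄π : ∀ x → 𝒩 x → x ≤ 1̄π
  𝒩⇒≤1̄π x hx = ⊓≡⇒≤ x 1̄π (𝒩⇒⊓1̄π≡ x hx)

  𝒩-1π⇒≡𝟎 : 𝒩 1π → ∀ z → z ≡ 𝟎
  𝒩-1π⇒≡𝟎 h z = begin
    z          ≡⟨ sym (∥-identity z) ⟩
    1π ∥ z     ≡⟨ cong (_∥ z) 1π≡𝟎 ⟩
    𝟎 ∥ z      ≡⟨ ∥-zero z ⟩
    𝟎          ∎
    where
    1π≡𝟎 : 1π ≡ 𝟎
    1π≡𝟎 = trans (sym (⊓-idem 1π)) (𝒩⇒1π⊓≡𝟎 h)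

  nontrivial⇒¬𝒩-1π : (Σ S λ a → Σ S λ b → a ≢ b) → ¬ 𝒩 1π
  nontrivial⇒¬𝒩-1π (a , b , a≢b) h =
    a≢b (trans (𝒩-1π⇒≡𝟎 h a) (sym (𝒩-1π⇒≡𝟎 h b)))

  IsBooleanReduct⇒𝒩IsBoolean : IsBooleanReduct → 𝒩IsBoolean
  IsBooleanReduct⇒𝒩IsBoolean boolean x hx with boolean x
  ... | y , x+y≡U , x⊓y≡𝟎 = y ⊓ 1̄π , 𝒩-⊓1̄π y , join , meet
    where
    join : x + y ⊓ 1̄π ≡ 1̄π
    join = begin
      x + y ⊓ 1̄π                ≡⟨ +-distrib-⊓ x y 1̄π ⟩
      (x + y) ⊓ (x + 1̄π)        ≡⟨ cong₂ _⊓_ x+y≡U (𝒩⇒≤1̄π x hx) ⟩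
      U ⊓ 1̄π                    ≡⟨ ⊓-comm U 1̄π ⟩
      1̄π ⊓ U                    ≡⟨ ⊓-identityʳ 1̄π ⟩
      1̄π                        ∎
    meet : x ⊓ (y ⊓ 1̄π) ≡ 𝟎
    meet = begin
      x ⊓ (y ⊓ 1̄π)     ≡⟨ sym (⊓-assoc x y 1̄π) ⟩
      (x ⊓ y) ⊓ 1̄π     ≡⟨ cong (_⊓ 1̄π) x⊓y≡𝟎 ⟩
      𝟎 ⊓ 1̄π           ≡⟨ ⊓-zeroˡ 1̄π ⟩
      𝟎                ∎

proposition33 : ∀ {ℓ : Level} (C : CLattice ℓ) → let open CLattice C in
    (𝒩 𝟎 × 𝒩 1σ × 𝒩 1̄π)
    × (∀ x y → 𝒩 x → 𝒩 y → 𝒩 (x + y))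
    × (∀ x y → 𝒩 x → 𝒩 y → 𝒩 (x ⊓ y))
    × (∀ x y → 𝒩 x → 𝒩 y → 𝒩 (x · y))
    × (∀ x y → 𝒩 x → 𝒩 y → 𝒩 (x ∥ y))
    × (∀ (x : S) → 𝒩 x → x ≤ 1̄π)
    × (∀ (x : S) → 𝒩 x → x · 𝟎 ≡ 𝟎)
    × ((Σ S λ a → Σ S λ b → a ≢ b) → ¬ 𝒩 1π)
    × (IsBooleanReduct → 𝒩IsBoolean)
proposition33 C =
    (𝒩-𝟎 C , 𝒩-1σ C , 𝒩-1̄π C)
  , 𝒩-+ C , 𝒩-⊓ C , 𝒩-· C , 𝒩-∥ C
  , 𝒩⇒≤1̄π C
  , (λ _ hx → hx)
  , nontrivial⇒¬𝒩-1π C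
  , IsBooleanReduct⇒𝒩IsBoolean C
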